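{- Let $r,s\ge 2$, let $P$ be a finite $(\mathbf{r}+\mathbf{s})$-free poset, let $C_1,\ldots,C_m$ be a First-Fit chain partition of $P$ with $C_j=\emptyset$ for $j>m$, and let $(S_0,F_0),\ldots,(S_n,F_n)$ be an evolution produced from the specific initial $2(s-1)$-society and replacement scheme described in the context, ending with $S_n=\emptyset$. Then $n\ge m+2$.
   Context: $\mathbf{r}$ is a chain of $r$ elements; $P$ is $(\mathbf{r}+\mathbf{s})$-free if it contains no chains $A,B$ of sizes $r,s$ with every element of $A$ incomparable to every element of $B$. A First-Fit chain partition of $P$ is an ordered partition $C_1,\ldots,C_m$ of $P$ into non-empty chains such that whenever $i<j$ and $x\in C_j$, some element of $C_i$ is incomparable to $x$. Initial society: let $q$ be the height of $P$ and $h(x)$ the size of a largest chain with maximum element $x$. Let $Z(x)$ be the set of $z$ such that $P$ has a chain of size $r$ with minimum $x$ and maximum $z$; let $b(x)=\min\{h(z):z\in Z(x)\}$ if $Z(x)\ne\emptyset$ and $b(x)=q+1$ otherwise; let $I(x)=\{h(x),\ldots,b(x)-1\}$. For $1\le k\le q$ let $X_k=\{x\in P: k\in I(x)\}$ (a group, i.e. subset of $P$). Let $t=2(s-1)$ and $\varepsilon=1/(2t)$. $S_0$ is the list $X_1,\ldots,X_q$; every $S_j$ is a sublist of $S_0$ with the inherited order, and $\mathrm{dist}_j(Y,Z)$ is the absolute difference of the positions of $Y$ and $Z$ in the list $S_j$. A $t$-society is a pair $(S,F)$ with $S$ a list of groups and $F:S\times\{1,\ldots,t\}\to S\cup\{\star\}$;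 $Y$ lists $Z$ as a friend if $F(Y,k)=Z$ for some $k$. $F_0$ is chosen so that each $Y\in S_0$ lists, each in one slot, exactly the groups $Z\neq Y$ in $S_0$ with $\mathrm{dist}_0(Y,Z)\le s-1$, unused slots being $\star$. Transitions: for $1\le j\le n$, $S_j$ consists of those $X\in S_{j-1}$ satisfying one of, with type the first that applies: ($\alpha$) $X\cap C_j\ne\emptyset$; ($\beta$) otherwise some friend of $X$ in $(S_{j-1},F_{j-1})$ meets $C_j$; ($\gamma$) otherwise there is $0\le i\le j-1$ with $N^\alpha_{i,j-1}(X)>\varepsilon(j-i)$, where $N^a_{i,j}(X)$ is the number of $l$ with $i<l\le j$, $X\in S_l$, such that $X$ makes a type-$a$ transition from $S_{l-1}$ to $S_l$. Replacement scheme: if $F_{j-1}(Y,k)=Z$ and $Y,Z\in S_j$ then $F_j(Y,k)=Z$; the groups $Z\in S_j$ with $\mathrm{dist}_{j-1}(Y,Z)>s-1$ and $\mathrm{dist}_j(Y,Z)\le s-1$ are placed arbitrarily into the slots of $Y$ whose previous friend did not survive to $S_j$, and remaining such slots get $\star$; thus in $(S_j,F_j)$ each $Y$ lists exactly the other groups $Z$ with $\mathrm{dist}_j(Y,Z)\le s-1$. The evolution ends at the index $n$ with $S_n=\emptyset$. -}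

module Defs where

open import Data.Nat using (ℕ; zero; suc; _+_; _*_; _∸_; _≤_; _<_; _≤?_; _<?_; ∣_-_∣)
open import Data.Fin using (Fin; toℕ)
import Data.Fin
open import Data.Fin.Properties using (any?)
open import Data.Bool using (Bool; true; false; _∧_; if_then_else_)
open import Data.Maybe using (Maybe; just; nothing)
open import Data.List using (List; length; allFin; map)
open import Data.Nat.ListAction using (sum)
open import Data.List.Membership.Propositional using (_∈_)
open import Data.List.Relation.Unary.All using (All)
open import Data.List.Relation.Unary.AllPairs using (AllPairs)
open import Data.List.Relation.Unary.Unique.Propositional using (Unique)
open import Data.Product using (Σ; Σ-syntax; ∃; _×_; _,_)
open import Data.Sum using (_⊎_)
open import Data.Empty using (⊥)
open import Relation.Nullary using (¬_; Dec; _×-dec_)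
open import Relation.Nullary.Decidable using (⌊_⌋)
open import Relation.Binary.PropositionalEquality using (_≡_; _≢_)
open import Data.Nat.Properties using (_≟_)

module _ {N : ℕ} (_≼_ : Fin N → Fin N → Set) where

  Comparable : Fin N → Fin N → Set
  Comparable x y = (x ≼ y) ⊎ (y ≼ x)

  Incomparable : Fin N → Fin N → Set
  Incomparable x y = ¬ Comparable x y

  IsChain : List (Fin N) → Set
  IsChain xs = Unique xs × AllPairs Comparable xs

  IsMaxOf : Fin N → List (Fin N) → Set
  IsMaxOf x xs = x ∈ xs × All (λ y → y ≼ x) xs

  IsMinOf : Fin N → List (Fin N) → Set
  IsMinOf x xs = x ∈ xs × All (λ y → x ≼ y) xs

  RSFree : ℕ → ℕ → Set
  RSFree r s = ¬ (Σ[ A ∈ List (Fin N) ] Σ[ B ∈ List (Fin N) ]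
                   (IsChain A × length A ≡ r × IsChain B × length B ≡ s ×
                    All (λ a → All (λ b → Incomparable a b) B) A))

  -- c x = index (0-based) of the chain containing x; chain C_{j+1} = c ⁻¹ (j).
  -- First-Fit chain partition C_1,...,C_m into non-empty chains.
  IsFirstFit : {m : ℕ} → (Fin N → Fin m) → Set
  IsFirstFit {m} c =
      (∀ (j : Fin m) → ∃ λ x → c x ≡ j)
    × (∀ x y → c x ≡ c y → Comparable x y)
    × (∀ (x : Fin N) (i : Fin m) → i Data.Fin.< c x → ∃ λ y → c y ≡ i × Incomparable y x)

  IsHeightOfP : ℕ → Set
  IsHeightOfP q = (Σ[ xs ∈ List (Fin N) ] IsChain xs × length xs ≡ q)
                × (∀ xs → IsChain xs → length xs ≤ q)

  IsHeightFn : (Fin N → ℕ) → Set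
  IsHeightFn h = ∀ x →
      (Σ[ xs ∈ List (Fin N) ] IsChain xs × IsMaxOf x xs × length xs ≡ h x)
    × (∀ xs → IsChain xs → IsMaxOf x xs → length xs ≤ h x)

  InZ : ℕ → Fin N → Fin N → Set
  InZ r x z = Σ[ xs ∈ List (Fin N) ]
                IsChain xs × length xs ≡ r × IsMinOf x xs × IsMaxOf z xs

  IsBFn : ℕ → ℕ → (Fin N → ℕ) → (Fin N → ℕ) → Set
  IsBFn r q h b = ∀ x →
      (Σ[ z ∈ Fin N ] InZ r x z × b x ≡ h z × (∀ z' → InZ r x z' → b x ≤ h z'))
    ⊎ ((∀ z → ¬ InZ r x z) × b x ≡ suc q)

infix 3 _⇔_
_⇔_ : Set → Set → Set
A ⇔ B = (A → B) × (B → A)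

tOf : ℕ → ℕ
tOf s = 2 * (s ∸ 1)

countFin : {q : ℕ} → (Fin q → Bool) → ℕ
countFin {q} p = sum (map (λ k → if p k then 1 else 0) (allFin q))

countRange : (ℕ → Bool) → ℕ → ℕ → ℕ
countRange p i zero = 0
countRange p i (suc j) with ⌊ i <? suc j ⌋
... | true  = (if p (suc j) then 1 else 0) + countRange p i j
... | false = 0

module _ {N m q : ℕ} (c : Fin N → Fin m) (h b : Fin N → ℕ) where

  -- The group X_k, with k = toℕ K + 1 for K : Fin q.
  -- x ∈ X_k  iff  k ∈ I(x) = {h(x), …, b(x)-1}
  InGroup : Fin q → Fin N → Set
  InGroup K x = h x ≤ suc (toℕ K) × suc (toℕ K) < b x

  -- x ∈ C_j  (j ≥ 1; C_j = ∅ for j > m, and C_0 = ∅ is never used)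
  InChain : ℕ → Fin N → Set
  InChain j x = suc (toℕ (c x)) ≡ j

  Meets : Fin q → ℕ → Set
  Meets K j = ∃ λ x → InChain j x × InGroup K x

  meets? : (K : Fin q) (j : ℕ) → Dec (Meets K j)
  meets? K j = any? (λ x → (suc (toℕ (c x)) ≟ j) ×-dec ((h x ≤? suc (toℕ K)) ×-dec (suc (toℕ K) <? b x)))

  -- a list S_j, as a sublist of S_0 = X_1,…,X_q, given by its membership
  Sub : Set
  Sub = Fin q → Bool

  pos : Sub → Fin q → ℕ
  pos S Y = countFin (λ K → S K ∧ ⌊ toℕ K <? toℕ Y ⌋)

  dist : Sub → Fin q → Fin q → ℕ
  dist S Y Z = ∣ pos S Y - pos S Z ∣

  module _ (s : ℕ) (S : ℕ → Sub) (F : ℕ → Fin q → Fin (tOf s) → Maybe (Fin q)) where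

    Nα : ℕ → ℕ → Fin q → ℕ
    Nα i j X = countRange (λ l → S l X ∧ ⌊ meets? X l ⌋) i j

    TypeA TypeB TypeC : ℕ → Fin q → Set
    TypeA j X = Meets X (suc j)
    TypeB j X = Σ[ k ∈ Fin (tOf s) ] Σ[ Z ∈ Fin q ] F j X k ≡ just Z × Meets Z (suc j)
    -- N^α_{i,j}(X) > ε (j+1-i) with ε = 1/(2t), i.e. (j+1-i) < 2t · N^α_{i,j}(X)
    TypeC j X = Σ[ i ∈ ℕ ] i ≤ j × (suc j ∸ i) < (2 * tOf s) * Nα i j X

    InitialFriends : Set
    InitialFriends = ∀ Y →
        (∀ k Z → F 0 Y k ≡ just Z → Z ≢ Y × dist (S 0) Y Z ≤ s ∸ 1)
      × (∀ Z → Z ≢ Y → dist (S 0) Y Z ≤ s ∸ 1 → ∃ λ k → F 0 Y k ≡ just Z)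
      × (∀ k k' Z → F 0 Y k ≡ just Z → F 0 Y k' ≡ just Z → k ≡ k')

    NewFriend : ℕ → Fin q → Fin q → Set
    NewFriend j Y Z = S (suc j) Z ≡ true × s ∸ 1 < dist (S j) Y Z × dist (S (suc j)) Y Z ≤ s ∸ 1

    Replacement : ℕ → Set
    Replacement j = ∀ Y → S (suc j) Y ≡ true →
        (∀ k Z → F j Y k ≡ just Z → S (suc j) Z ≡ true → F (suc j) Y k ≡ just Z)
      × (∀ k Z → F j Y k ≡ just Z → S (suc j) Z ≡ false →
           (F (suc j) Y k ≡ nothing) ⊎ (Σ[ Z' ∈ Fin q ] F (suc j) Y k ≡ just Z' × NewFriend j Y Z'))
      × (∀ k → F j Y k ≡ nothing → F (suc j) Y k ≡ nothing)
      × (∀ Z → NewFriend j Y Z → ∃ λ k → F (suc j) Y k ≡ just Z)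
      × (∀ k k' Z → F (suc j) Y k ≡ just Z → F (suc j) Y k' ≡ just Z → k ≡ k')

    IsEvolution : ℕ → Set
    IsEvolution n =
        (∀ X → S 0 X ≡ true)
      × InitialFriends
      × (∀ j → j < n → ∀ X →
           (S (suc j) X ≡ true) ⇔ (S j X ≡ true × (TypeA j X ⊎ TypeB j X ⊎ TypeC j X)))
      × (∀ j → j < n → Replacement j)

-- The invariant is that every element x of a chain C_{j'} with j' > j lies in a group of S_j.
-- For the step from S_j, First-Fit gives y ∈ C_{j+1} incomparable to x, and (r+s)-freeness gives
-- h(y) < b(x) + s - 1: otherwise s elements of height at least h(z) on a longest chain below y
-- would be incomparable to an r-chain from x up to some z with h(z) = b(x).  Hence the closest
-- groups of S_j containing x and y are at distance at most s - 1, so they are friends, and the one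
-- containing x survives by (α) or (β).  For x ∈ C_m this yields a group of S_{m-1} meeting C_m;
-- it enters S_m by (α) and then S_{m+1} by (γ) with i = m - 1, so S_n = ∅ forces n ≥ m + 2.

module Submission where

open import Defs
open import Algebra.Properties.CommutativeSemigroup using (interchange)
open import Data.Bool using (Bool; true; false; _∧_; if_then_else_)
import Data.Bool.Properties as Bool
open import Data.Empty using (⊥-elim)
open import Data.Fin using (Fin; toℕ; fromℕ; fromℕ<) renaming (zero to fzero; suc to fsuc)
open import Data.Fin.Properties using (toℕ-fromℕ; toℕ-fromℕ<; toℕ<n; toℕ-injective; any?)
import Data.Fin.Properties as Fin
open import Data.List using (List; []; _∷_; [_]; length; map; allFin; filter; take)
open import Data.List.Properties using (map-tabulate; length-take)
open import Data.List.Relation.Unary.Any using (here; there)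
open import Data.List.Relation.Unary.All as All using (All; []; _∷_; lookup)
open import Data.List.Relation.Unary.All.Properties using (all-filter)
import Data.List.Relation.Unary.All.Properties as All
open import Data.List.Relation.Unary.AllPairs using (AllPairs; []; _∷_)
import Data.List.Relation.Unary.AllPairs.Properties as AllPairs
open import Data.List.Relation.Unary.Unique.Propositional using (Unique)
import Data.List.Relation.Unary.Unique.Propositional.Properties as Unique
open import Data.Maybe using (Maybe; just)
open import Data.Nat using (ℕ; zero; suc; pred; NonZero; >-nonZero; _+_; _*_; _∸_; _≤_; _<_; z≤n; s≤s)
open import Data.Nat.ListAction using (sum)
open import Data.Nat.Properties
open import Data.Product using (Σ-syntax; ∃; _×_; _,_; proj₁; proj₂)
open import Data.Sum using (_⊎_; inj₁; inj₂; swap)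
open import Function using (_∘_; id)
open import Relation.Binary.Definitions using (tri<; tri≈; tri>)
open import Relation.Binary.PropositionalEquality using (_≡_; _≢_; refl; sym; trans; cong; subst)
open import Relation.Binary.Structures using (IsPartialOrder)
open import Relation.Nullary using (¬_; yes; no; contradiction; _×-dec_; _⊎-dec_)
open import Relation.Nullary.Decidable using (⌊_⌋)
open import Relation.Unary using (Decidable)
open import Relation.Unary.Properties using (∁?)

indicator : Bool → ℕ
indicator b = if b then 1 else 0

sum-map-mono : {A : Set} {f g : A → ℕ} → (∀ a → f a ≤ g a) →
               ∀ xs → sum (map f xs) ≤ sum (map g xs)
sum-map-mono f≤g []       = z≤n
sum-map-mono f≤g (x ∷ xs) = +-mono-≤ (f≤g x) (sum-map-mono f≤g xs)

sum-map-≤-+ : {A : Set} {f g k : A → ℕ} → (∀ a → f a ≤ g a + k a) →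
              ∀ xs → sum (map f xs) ≤ sum (map g xs) + sum (map k xs)
sum-map-≤-+ f≤g+k []                    = z≤n
sum-map-≤-+ {g = g} {k} f≤g+k (x ∷ xs) =
  ≤-trans (+-mono-≤ (f≤g+k x) (sum-map-≤-+ f≤g+k xs))
          (≤-reflexive (interchange +-commutativeSemigroup
                          (g x) (k x) (sum (map g xs)) (sum (map k xs))))

countFin-suc : ∀ {q} (p : Fin (suc q) → Bool) →
               countFin p ≡ indicator (p fzero) + countFin (p ∘ fsuc)
countFin-suc {q} p = cong (λ ks → indicator (p fzero) + sum ks)
  (trans (map-tabulate fsuc (indicator ∘ p)) (sym (map-tabulate id (indicator ∘ p ∘ fsuc))))

countFin-≤-width : ∀ {q} (p : Fin q → Bool) lo hi →
                   (∀ K → p K ≡ true → lo ≤ toℕ K × toℕ K < hi) → countFin p ≤ hi ∸ lo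
countFin-≤-width {zero}  p lo hi inside = z≤n
countFin-≤-width {suc q} p lo hi inside rewrite countFin-suc p with p fzero in p0
... | true with inside fzero p0
...   | z≤n , s≤s {n = hi′} _ = s≤s (countFin-≤-width (p ∘ fsuc) 0 hi′ shifted)
  where
  shifted : ∀ K → p (fsuc K) ≡ true → 0 ≤ toℕ K × toℕ K < hi′
  shifted K pK with inside (fsuc K) pK
  ... | _ , s≤s K<hi′ = z≤n , K<hi′
countFin-≤-width {suc q} p lo hi inside | false =
  ≤-trans (countFin-≤-width (p ∘ fsuc) (pred lo) (pred hi) shifted) (pred∸pred≤∸ lo hi)
  where
  shifted : ∀ K → p (fsuc K) ≡ true → pred lo ≤ toℕ K × toℕ K < pred hi
  shifted K pK with inside (fsuc K) pK
  ... | lo≤1+K , 1+K<hi = pred-mono-≤ lo≤1+K , pred-mono-≤ 1+K<hi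
  pred∸pred≤∸ : ∀ m n → pred n ∸ pred m ≤ n ∸ m
  pred∸pred≤∸ zero    zero    = z≤n
  pred∸pred≤∸ zero    (suc n) = n≤1+n n
  pred∸pred≤∸ (suc m) zero    = ≤-reflexive (0∸n≡0 m)
  pred∸pred≤∸ (suc m) (suc n) = ≤-refl

inRange : ∀ {q} → ℕ → ℕ → Fin q → Bool
inRange lo hi K = ⌊ lo ≤? toℕ K ⌋ ∧ ⌊ toℕ K <? hi ⌋

countFin-inRange : ∀ {q} lo hi → countFin (inRange {q} lo hi) ≤ hi ∸ lo
countFin-inRange {q} lo hi = countFin-≤-width (inRange lo hi) lo hi inside
  where
  inside : (K : Fin q) → inRange lo hi K ≡ true → lo ≤ toℕ K × toℕ K < hi
  inside K eq with lo ≤? toℕ K | toℕ K <? hi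
  inside K refl | yes lo≤K | yes K<hi = lo≤K , K<hi

module _ {N m q : ℕ} (c : Fin N → Fin m) (h b : Fin N → ℕ) (S : Fin q → Bool) where

  MembersBetweenIn : Fin q → Fin q → ℕ → ℕ → Set
  MembersBetweenIn u v lo hi =
    ∀ K → toℕ u < toℕ K → toℕ K < toℕ v → S K ≡ true → lo ≤ toℕ K × toℕ K < hi

  pos-mono : ∀ {u v} → toℕ u ≤ toℕ v → pos c h b S u ≤ pos c h b S v
  pos-mono {u} {v} u≤v = sum-map-mono pointwise (allFin q)
    where
    pointwise : ∀ K → indicator (S K ∧ ⌊ toℕ K <? toℕ u ⌋) ≤
                      indicator (S K ∧ ⌊ toℕ K <? toℕ v ⌋)
    pointwise K with S K | toℕ K <? toℕ u | toℕ K <? toℕ v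
    ... | false | _       | _       = z≤n
    ... | true  | no _    | _       = z≤n
    ... | true  | yes _   | yes _   = ≤-refl
    ... | true  | yes K<u | no K≮v  = contradiction (<-≤-trans K<u u≤v) K≮v

  -- Only u itself and the members of S strictly between u and v separate their positions.
  pos-≤ : ∀ {u v} lo hi → MembersBetweenIn u v lo hi →
          pos c h b S v ≤ pos c h b S u + suc (hi ∸ lo)
  pos-≤ {u} {v} lo hi between =
    ≤-trans (sum-map-≤-+ pointwise (allFin q))
      (+-monoʳ-≤ (pos c h b S u)
        (≤-trans (sum-map-≤-+ (λ _ → ≤-refl) (allFin q))
                 (+-mono-≤ u-once (countFin-inRange {q} lo hi))))
    where
    u-once : countFin (inRange {q} (toℕ u) (suc (toℕ u))) ≤ 1
    u-once = ≤-trans (countFin-inRange {q} (toℕ u) (suc (toℕ u))) (≤-reflexive (m+n∸n≡m 1 (toℕ u)))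
    pointwise : ∀ K → indicator (S K ∧ ⌊ toℕ K <? toℕ v ⌋) ≤
                      indicator (S K ∧ ⌊ toℕ K <? toℕ u ⌋) +
                      (indicator (inRange (toℕ u) (suc (toℕ u)) K) + indicator (inRange lo hi K))
    pointwise K with S K in SK | toℕ K <? toℕ v | toℕ K <? toℕ u
    ... | false | _       | _     = z≤n
    ... | true  | no _    | _     = z≤n
    ... | true  | yes _   | yes _ = s≤s z≤n
    ... | true  | yes K<v | no K≮u with toℕ K <? suc (toℕ u)
    ...   | yes _ with toℕ u ≤? toℕ K
    ...     | yes _   = s≤s z≤n
    ...     | no u≰K  = contradiction (≮⇒≥ K≮u) u≰K
    pointwise K | true | yes K<v | no K≮u | no K≰u
      with between K (≮⇒≥ K≰u) K<v SK | lo ≤? toℕ K | toℕ K <? hi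
    ... | _ , _     | yes _    | yes _    = m≤n+m 1 _
    ... | lo≤K , _  | no lo≰K  | _        = contradiction lo≤K lo≰K
    ... | _ , K<hi  | yes _    | no K≮hi  = contradiction K<hi K≮hi

  dist-≤ : ∀ {u v} lo hi → toℕ u ≤ toℕ v → MembersBetweenIn u v lo hi →
           dist c h b S u v ≤ suc (hi ∸ lo)
  dist-≤ {u} {v} lo hi u≤v between rewrite m≤n⇒∣m-n∣≡n∸m (pos-mono u≤v) =
    m≤n+o⇒m∸n≤o (pos c h b S v) (pos c h b S u) (pos-≤ lo hi between)

module _ {q : ℕ} {P Q : Fin q → Set} (P? : Decidable P) (Q? : Decidable Q) where

  ClosestPair : Set
  ClosestPair = Σ[ a ∈ Fin q ] Σ[ b ∈ Fin q ] P a × Q b × toℕ a < toℕ b ×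
                  (∀ K → toℕ a < toℕ K → toℕ K < toℕ b → ¬ P K × ¬ Q K)

  closest-pair : ∀ {a b} → P a → Q b → toℕ a < toℕ b → ClosestPair
  closest-pair {a} {b} = shrink (toℕ b ∸ toℕ a) ≤-refl
    where
    shrink : ∀ d {a b} → toℕ b ∸ toℕ a ≤ d → P a → Q b → toℕ a < toℕ b → ClosestPair
    shrink zero    b∸a≤0 _  _  a<b = contradiction b∸a≤0 (<⇒≱ (m<n⇒0<n∸m a<b))
    shrink (suc d) {a} {b} b∸a≤1+d Pa Qb a<b
      with any? (λ K → ((toℕ a <? toℕ K) ×-dec (toℕ K <? toℕ b)) ×-dec (P? K ⊎-dec Q? K))
    ... | yes (K , (a<K , K<b) , inj₁ PK) =
      shrink d (≤-pred (≤-trans (∸-monoʳ-< a<K (<⇒≤ K<b)) b∸a≤1+d)) PK Qb K<b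
    ... | yes (K , (a<K , K<b) , inj₂ QK) =
      shrink d (≤-pred (≤-trans (∸-monoˡ-< K<b (<⇒≤ a<K)) b∸a≤1+d)) Pa QK a<K
    ... | no none = a , b , Pa , Qb , a<b ,
      λ K a<K K<b → (λ PK → none (K , (a<K , K<b) , inj₁ PK)) ,
                    (λ QK → none (K , (a<K , K<b) , inj₂ QK))

length-filter+length-filter-∁ : {A : Set} {P : A → Set} (P? : Decidable P) (xs : List A) →
                                length (filter P? xs) + length (filter (∁? P?) xs) ≡ length xs
length-filter+length-filter-∁ P? []       = refl
length-filter+length-filter-∁ P? (x ∷ xs) with P? x
... | yes _ = cong suc (length-filter+length-filter-∁ P? xs)
... | no _  = trans (+-suc _ _) (cong suc (length-filter+length-filter-∁ P? xs))

s+pred[n]≤n+[s∸1] : ∀ s n → .{{NonZero n}} → s + pred n ≤ n + (s ∸ 1)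
s+pred[n]≤n+[s∸1] zero    (suc n) = m≤n⇒m≤1+n (m≤m+n n 0)
s+pred[n]≤n+[s∸1] (suc s) (suc n) = s≤s (≤-reflexive (+-comm s n))

module Heights {N : ℕ} {_≼_ : Fin N → Fin N → Set} (po : IsPartialOrder _≡_ _≼_)
               {h : Fin N → ℕ} (hF : IsHeightFn _≼_ h) where

  open IsPartialOrder po using (antisym) renaming (refl to ≼-refl; trans to ≼-trans)

  chain-maximum : ∀ {x xs} → AllPairs (Comparable _≼_) (x ∷ xs) →
                  Σ[ w ∈ Fin N ] IsMaxOf _≼_ w (x ∷ xs)
  chain-maximum {x} {[]}     _ = x , here refl , ≼-refl ∷ []
  chain-maximum {x} {y ∷ ys} (x~ ∷ comparable) with chain-maximum comparable
  ... | w , w∈ , below-w with lookup x~ w∈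
  ...   | inj₁ x≼w = w , there w∈ , x≼w ∷ below-w
  ...   | inj₂ w≼x = x , here refl , ≼-refl ∷ All.map (λ v≼w → ≼-trans v≼w w≼x) below-w

  h-positive : ∀ x → 1 ≤ h x
  h-positive x = proj₂ (hF x) [ x ] ([] ∷ [] , [] ∷ []) (here refl , ≼-refl ∷ [])

  h-strict : ∀ {u a} → u ≼ a → u ≢ a → h u < h a
  h-strict {u} {a} u≼a u≢a with proj₁ (hF u)
  ... | xs , (unique , comparable) , (_ , below-u) , |xs|≡hu =
    subst (_≤ h a) (cong suc |xs|≡hu)
      (proj₂ (hF a) (a ∷ xs) (a∉xs ∷ unique , All.map inj₂ below-a ∷ comparable)
                             (here refl , ≼-refl ∷ below-a))
    where
    below-a : All (_≼ a) xs
    below-a = All.map (λ y≼u → ≼-trans y≼u u≼a) below-u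
    a∉xs : All (a ≢_) xs
    a∉xs = All.map (λ y≼u a≡y → u≢a (antisym u≼a (subst (_≼ u) (sym a≡y) y≼u))) below-u

  h-mono : ∀ {u a} → u ≼ a → h u ≤ h a
  h-mono {u} {a} u≼a with u Fin.≟ a
  ... | yes refl = ≤-refl
  ... | no u≢a   = <⇒≤ (h-strict u≼a u≢a)

  -- The maximum of such a chain has height at least its length.
  chain-length≤ : ∀ {xs t} → IsChain _≼_ xs → All (λ u → h u ≤ t) xs → length xs ≤ t
  chain-length≤ {[]}     _                      _     = z≤n
  chain-length≤ {x ∷ xs} chain@(_ , comparable) low with chain-maximum comparable
  ... | w , w-max@(w∈ , _) = ≤-trans (proj₂ (hF w) (x ∷ xs) chain w-max) (lookup low w∈)

  tall-chain-below : ∀ {y} k t → k + t ≤ h y →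
    Σ[ B ∈ List (Fin N) ] IsChain _≼_ B × length B ≡ k × All (λ u → u ≼ y × t < h u) B
  tall-chain-below {y} k t k+t≤hy with proj₁ (hF y)
  ... | ys , (unique , comparable) , (_ , below-y) , |ys|≡hy =
    take k tall ,
    (Unique.take⁺ k (Unique.filter⁺ tall? unique) ,
     AllPairs.take⁺ k (AllPairs.filter⁺ tall? comparable)) ,
    trans (length-take k tall) (m≤n⇒m⊓n≡m k≤|tall|) ,
    All.take⁺ k (All.zip (All.filter⁺ tall? below-y , all-filter tall? ys))
    where
    tall? : Decidable (λ u → t < h u)
    tall? u = t <? h u
    tall short : List (Fin N)
    tall  = filter tall? ys
    short = filter (∁? tall?) ys
    |short|≤t : length short ≤ t
    |short|≤t = chain-length≤
      (Unique.filter⁺ (∁? tall?) unique , AllPairs.filter⁺ (∁? tall?) comparable)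
      (All.map ≮⇒≥ (all-filter (∁? tall?) ys))
    k≤|tall| : k ≤ length tall
    k≤|tall| = +-cancelʳ-≤ t k (length tall) (begin
      k + t                         ≤⟨ k+t≤hy ⟩
      h y                           ≡⟨ sym |ys|≡hy ⟩
      length ys                     ≡⟨ sym (length-filter+length-filter-∁ tall? ys) ⟩
      length tall + length short    ≤⟨ +-monoʳ-≤ (length tall) |short|≤t ⟩
      length tall + t               ∎)
      where open ≤-Reasoning

  module _ {r q : ℕ} {b : Fin N → ℕ} (hP : IsHeightOfP _≼_ q) (bF : IsBFn _≼_ r q h b) where

    h≤q : ∀ x → h x ≤ q
    h≤q x with proj₁ (hF x)
    ... | xs , chain , _ , |xs|≡hx = subst (_≤ q) |xs|≡hx (proj₂ hP xs chain)

    h<b : 2 ≤ r → ∀ x → h x < b x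
    h<b r≥2 x with bF x
    ... | inj₂ (_ , bx≡1+q) rewrite bx≡1+q = s≤s (h≤q x)
    ... | inj₁ (z , (A , (unique , _) , |A|≡r , (_ , above-x) , (z∈A , below-z)) , bx≡hz , _)
      rewrite bx≡hz =
      h-strict (lookup above-x z∈A) (x≢z A unique |A|≡r above-x below-z)
      where
      x≢z : ∀ A → Unique A → length A ≡ r → All (x ≼_) A → All (_≼ z) A → x ≢ z
      x≢z []           _                |A|≡r _                _                refl =
        <⇒≱ r≥2 (subst (_≤ 1) |A|≡r z≤n)
      x≢z (_ ∷ [])     _                |A|≡r _                _                refl =
        <⇒≱ r≥2 (≤-reflexive (sym |A|≡r))
      x≢z (a ∷ a′ ∷ _) ((a≢a′ ∷ _) ∷ _) _     (x≼a ∷ x≼a′ ∷ _) (a≼x ∷ a′≼x ∷ _) refl =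
        a≢a′ (trans (antisym a≼x x≼a) (antisym x≼a′ a′≼x))

    incomparable⇒h<b+[s∸1] : ∀ {s} → RSFree _≼_ r s → ∀ {x y} → Incomparable _≼_ x y →
                             h y < b x + (s ∸ 1)
    incomparable⇒h<b+[s∸1] {s} rsf {x} {y} x∥y with bF x
    ... | inj₂ (_ , bx≡1+q) rewrite bx≡1+q = s≤s (≤-trans (h≤q y) (m≤m+n q (s ∸ 1)))
    ... | inj₁ (z , (A , A-chain , |A|≡r , (_ , above-x) , (_ , below-z)) , bx≡hz , _) rewrite bx≡hz
      with h y <? h z + (s ∸ 1)
    ...   | yes hy<hz+[s∸1] = hy<hz+[s∸1]
    ...   | no  hy≮hz+[s∸1]
      with tall-chain-below s (pred (h z))
             (≤-trans (s+pred[n]≤n+[s∸1] s (h z) {{>-nonZero (h-positive z)}}) (≮⇒≥ hy≮hz+[s∸1]))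
    ...     | B , B-chain , |B|≡s , below-y =
      ⊥-elim (rsf (A , B , A-chain , |A|≡r , B-chain , |B|≡s ,
           All.map (λ (x≼a , a≼z) → All.map (λ (u≼y , tall) → a∥u x≼a a≼z u≼y tall) below-y)
                   (All.zip (above-x , below-z))))
      where
      a∥u : ∀ {a u} → x ≼ a → a ≼ z → u ≼ y → pred (h z) < h u → Incomparable _≼_ a u
      a∥u x≼a a≼z u≼y _ (inj₁ a≼u) = x∥y (inj₁ (≼-trans x≼a (≼-trans a≼u u≼y)))
      a∥u {a} {u} x≼a a≼z u≼y tall (inj₂ u≼a) with u Fin.≟ a
      ... | yes refl = x∥y (inj₁ (≼-trans x≼a u≼y))
      ... | no u≢a   =
        <⇒≱ tall (suc[m]≤n⇒m≤pred[n] {n = h z} (≤-trans (h-strict u≼a u≢a) (h-mono a≼z)))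

countRange-last : ∀ (p : ℕ → Bool) j → p (suc j) ≡ true → 1 ≤ countRange p j (suc j)
countRange-last p j p[1+j] with j <? suc j
... | yes _      rewrite p[1+j] = s≤s z≤n
... | no j≮1+j  = contradiction (n<1+n j) j≮1+j

-- The witness is i = j, where N^α_{j,j+1}(X) = 1 > ε · 2.
TypeA⇒next-TypeC : ∀ {N m q s} {c : Fin N → Fin m} {h b : Fin N → ℕ} {S : ℕ → Fin q → Bool}
                   {F : ℕ → Fin q → Fin (tOf s) → Maybe (Fin q)} → 2 ≤ s →
                   ∀ {j X} → S (suc j) X ≡ true → TypeA c h b s S F j X → TypeC c h b s S F (suc j) X
TypeA⇒next-TypeC {s = s} {c} {h} {b} {S} {F} s≥2 {j} {X} S[1+j]X meets =
  j , n≤1+n j , subst (_< 2 * tOf s * Nα c h b s S F j (suc j) X) (sym (m+n∸n≡m 2 j))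
                      (≤-trans (n≤1+n 3) (*-mono-≤ 4≤2t (countRange-last _ j active)))
  where
  4≤2t : 4 ≤ 2 * tOf s
  4≤2t = *-monoʳ-≤ 2 (*-monoʳ-≤ 2 (∸-monoˡ-≤ 1 s≥2))
  active : (S (suc j) X ∧ ⌊ meets? c h b X (suc j) ⌋) ≡ true
  active rewrite S[1+j]X with meets? c h b X (suc j)
  ... | yes _      = refl
  ... | no ¬meets  = contradiction meets ¬meets

module Evolution {r s : ℕ} (r≥2 : 2 ≤ r) (s≥2 : 2 ≤ s)
  {N : ℕ} {_≼_ : Fin N → Fin N → Set} (po : IsPartialOrder _≡_ _≼_) (rsf : RSFree _≼_ r s)
  {m : ℕ} {c : Fin N → Fin m} (ff : IsFirstFit _≼_ c)
  {q : ℕ} (hP : IsHeightOfP _≼_ q)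
  {h : Fin N → ℕ} (hF : IsHeightFn _≼_ h)
  {b : Fin N → ℕ} (bF : IsBFn _≼_ r q h b)
  {S : ℕ → Fin q → Bool} {F : ℕ → Fin q → Fin (tOf s) → Maybe (Fin q)} {n : ℕ}
  (ev : IsEvolution c h b s S F n) where

  open Heights po hF

  dist[_] : ℕ → Fin q → Fin q → ℕ
  dist[ j ] = dist c h b (S j)

  Contains : ℕ → Fin q → Fin N → Set
  Contains j K x = S j K ≡ true × InGroup c h b K x

  contains? : ∀ j x → Decidable (λ K → Contains j K x)
  contains? j x K = (S j K Bool.≟ true) ×-dec ((h x ≤? suc (toℕ K)) ×-dec (suc (toℕ K) <? b x))

  Covered : ℕ → Fin N → Set
  Covered j x = ∃ λ K → Contains j K x

  present-before : ∀ {j X} → j < n → S (suc j) X ≡ true → S j X ≡ true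
  present-before j<n S[1+j]X = proj₁ (proj₁ (proj₁ (proj₂ (proj₂ ev)) _ j<n _) S[1+j]X)

  stays : ∀ {j X} → j < n → S j X ≡ true →
          TypeA c h b s S F j X ⊎ TypeB c h b s S F j X ⊎ TypeC c h b s S F j X → S (suc j) X ≡ true
  stays j<n SX transition = proj₂ (proj₁ (proj₂ (proj₂ ev)) _ j<n _) (SX , transition)

  initial-friends : InitialFriends c h b s S F
  initial-friends = proj₁ (proj₂ ev)

  replacement : ∀ {j} → j < n → Replacement c h b s S F j
  replacement j<n = proj₂ (proj₂ (proj₂ ev)) _ j<n

  friends : ∀ j → j ≤ n → ∀ {Y Z} → S j Y ≡ true → S j Z ≡ true → Z ≢ Y →
            dist[ j ] Y Z ≤ s ∸ 1 → ∃ λ k → F j Y k ≡ just Z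
  friends zero    _   _ _ Z≢Y close = proj₁ (proj₂ (initial-friends _)) _ Z≢Y close
  friends (suc j) j<n {Y} {Z} SY SZ Z≢Y close with s ∸ 1 <? dist[ j ] Y Z
  ... | yes far = proj₁ (proj₂ (proj₂ (proj₂ (replacement j<n Y SY)))) Z (SZ , far , close)
  ... | no ¬far
    with friends j (<⇒≤ j<n) (present-before j<n SY) (present-before j<n SZ) Z≢Y (≮⇒≥ ¬far)
  ...   | k , F[j]Yk≡Z = k , proj₁ (replacement j<n Y SY) k Z F[j]Yk≡Z SZ

  survives-beside : ∀ {j L L′} → j < n → S j L ≡ true → S j L′ ≡ true →
                    dist[ j ] L L′ ≤ s ∸ 1 → Meets c h b L′ (suc j) → S (suc j) L ≡ true
  survives-beside {L = L} {L′} j<n SL SL′ close meets with L′ Fin.≟ L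
  ... | yes refl = stays j<n SL (inj₁ meets)
  ... | no L′≢L with friends _ (<⇒≤ j<n) SL SL′ L′≢L close
  ...   | k , F[j]Lk≡L′ = stays j<n SL (inj₂ (inj₁ (k , L′ , F[j]Lk≡L′ , meets)))

  NearbyGroups : ℕ → Fin N → Fin N → Set
  NearbyGroups j x y =
    Σ[ L ∈ Fin q ] Σ[ L′ ∈ Fin q ] Contains j L x × Contains j L′ y × dist[ j ] L L′ ≤ s ∸ 1

  -- Between the closest groups of x and y, every group of S_j has index in [b x, h y).
  nearby-groups-ordered : ∀ {j x y K K′} → Incomparable _≼_ x y →
                          Contains j K x → Contains j K′ y → toℕ K < toℕ K′ → NearbyGroups j x y
  nearby-groups-ordered {j} {x} {y} x∥y Kx K′y K<K′
    with closest-pair (contains? j x) (contains? j y) Kx K′y K<K′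
  ... | L , L′ , Lx@(_ , hx≤1+L , _) , L′y@(_ , _ , 1+L′<by) , L<L′ , outside =
    L , L′ , Lx , L′y ,
    ≤-trans (dist-≤ c h b (S j) (b x ∸ 1) (h y ∸ 1) (<⇒≤ L<L′) between)
            (width {{>-nonZero (∸-monoˡ-≤ 1 s≥2)}} 1≤bx (incomparable⇒h<b+[s∸1] hP bF rsf x∥y))
    where
    1≤bx : 1 ≤ b x
    1≤bx = ≤-trans (h-positive x) (<⇒≤ (h<b hP bF r≥2 x))
    width : ∀ {a b t} → .{{NonZero t}} → 1 ≤ b → a < b + t → suc ((a ∸ 1) ∸ (b ∸ 1)) ≤ t
    width {a} {b} 1≤b a<b+t rewrite ∸-+-assoc a 1 (b ∸ 1) | m+[n∸m]≡n 1≤b = m<n+o⇒m∸n<o a b a<b+t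
    between : MembersBetweenIn c h b (S j) L L′ (b x ∸ 1) (h y ∸ 1)
    between K L<K K<L′ SK with outside K L<K K<L′
    ... | ¬Kx , ¬Ky =
      ∸-monoˡ-≤ 1 (≮⇒≥ λ 1+K<bx → ¬Kx (SK , ≤-trans hx≤1+L (<⇒≤ (s≤s L<K)) , 1+K<bx)) ,
      ∸-monoˡ-≤ 1 (≰⇒> λ hy≤1+K → ¬Ky (SK , hy≤1+K , <-trans (s≤s K<L′) 1+L′<by))

  nearby-groups : ∀ {j x y K K′} → Incomparable _≼_ x y →
                  Contains j K x → Contains j K′ y → NearbyGroups j x y
  nearby-groups {j} {K = K} {K′} x∥y Kx K′y with <-cmp (toℕ K) (toℕ K′)
  ... | tri< K<K′ _ _ = nearby-groups-ordered x∥y Kx K′y K<K′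
  ... | tri≈ _ K≡K′ _ rewrite toℕ-injective K≡K′ =
    K′ , K′ , Kx , K′y , ≤-trans (≤-reflexive (∣n-n∣≡0 (pos c h b (S j) K′))) z≤n
  ... | tri> _ _ K′<K with nearby-groups-ordered (x∥y ∘ swap) K′y Kx K′<K
  ...   | L′ , L , L′y , Lx , close =
    L , L′ , Lx , L′y ,
    ≤-trans (≤-reflexive (∣-∣-comm (pos c h b (S j) L) (pos c h b (S j) L′))) close

  first-fit-below : ∀ x {j} → j < toℕ (c x) →
                    Σ[ y ∈ Fin N ] toℕ (c y) ≡ j × Incomparable _≼_ y x
  first-fit-below x {j} j<cx =
    let j<m = <-trans j<cx (toℕ<n (c x))
        i<cx = subst (_< toℕ (c x)) (sym (toℕ-fromℕ< j<m)) j<cx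
        y , cy≡i , y∥x = proj₂ (proj₂ ff) x (fromℕ< j<m) i<cx
    in y , trans (cong toℕ cy≡i) (toℕ-fromℕ< j<m) , y∥x

  covered-initially : ∀ x → Covered 0 x
  covered-initially x =
    K , proj₁ ev K , ≤-reflexive (sym 1+K≡hx) , subst (_< b x) (sym 1+K≡hx) (h<b hP bF r≥2 x)
    where
    1+pred[hx]≡hx : suc (pred (h x)) ≡ h x
    1+pred[hx]≡hx = suc-pred (h x) {{>-nonZero (h-positive x)}}
    K : Fin q
    K = fromℕ< (subst (_≤ q) (sym 1+pred[hx]≡hx) (h≤q hP bF x))
    1+K≡hx : suc (toℕ K) ≡ h x
    1+K≡hx = trans (cong suc (toℕ-fromℕ< _)) 1+pred[hx]≡hx

  covered : ∀ j → j ≤ n → ∀ x → j ≤ toℕ (c x) → Covered j x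
  covered zero    _   x _ = covered-initially x
  covered (suc j) j<n x j<cx with first-fit-below x j<cx
  ... | y , cy≡j , y∥x
    with covered j (<⇒≤ j<n) x (<⇒≤ j<cx) | covered j (<⇒≤ j<n) y (≤-reflexive (sym cy≡j))
  ...   | K , Kx | K′ , K′y with nearby-groups (y∥x ∘ swap) Kx K′y
  ...     | L , L′ , (SL , x∈L) , (SL′ , y∈L′) , close =
    L , survives-beside j<n SL SL′ close (y , cong suc cy≡j , y∈L′) , x∈L

  module _ (extinct : ∀ X → S n X ≡ false) where

    absent-at-end : ∀ {X} → ¬ (S n X ≡ true)
    absent-at-end {X} SnX with trans (sym SnX) (extinct X)
    ... | ()

    present⇒<n : ∀ {j X} → j ≤ n → S j X ≡ true → j < n
    present⇒<n j≤n SX with m≤n⇒m<n∨m≡n j≤n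
    ... | inj₁ j<n  = j<n
    ... | inj₂ refl = ⊥-elim (absent-at-end SX)

    chain-index<n : ∀ x → toℕ (c x) < n
    chain-index<n x with toℕ (c x) ≤? n
    ... | yes cx≤n = present⇒<n cx≤n (proj₁ (proj₂ (covered _ cx≤n x ≤-refl)))
    ... | no  cx≰n =
      ⊥-elim (absent-at-end (proj₁ (proj₂ (covered n ≤-refl x (<⇒≤ (≰⇒> cx≰n))))))

last-index : ∀ {m} → Fin m → Σ[ i ∈ Fin m ] suc (toℕ i) ≡ m
last-index {suc m} _ = fromℕ m , cong suc (toℕ-fromℕ m)

lemma7 : (r s : ℕ) → 2 ≤ r → 2 ≤ s →
    (N : ℕ) → 0 < N →
    (_≼_ : Fin N → Fin N → Set) → IsPartialOrder _≡_ _≼_ → RSFree _≼_ r s →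
    (m : ℕ) (c : Fin N → Fin m) → IsFirstFit _≼_ c →
    (q : ℕ) → IsHeightOfP _≼_ q →
    (h : Fin N → ℕ) → IsHeightFn _≼_ h →
    (b : Fin N → ℕ) → IsBFn _≼_ r q h b →
    (S : ℕ → Fin q → Bool) (F : ℕ → Fin q → Fin (tOf s) → Maybe (Fin q)) (n : ℕ) →
    IsEvolution c h b s S F n →
    (∀ X → S n X ≡ false) →
    m + 2 ≤ n
lemma7 r s r≥2 s≥2 N N>0 _≼_ po rsf m c ff q hP h hF b bF S F n ev extinct =
  subst (_≤ n) (trans (cong (suc ∘ suc) 1+l≡m) (+-comm 2 m)) 2+l<n
  where
  open Evolution r≥2 s≥2 po rsf ff hP hF bF ev
  x : Fin N
  x = proj₁ (proj₁ ff (proj₁ (last-index (c (fromℕ< N>0)))))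
  l : ℕ
  l = toℕ (c x)
  1+l≡m : suc l ≡ m
  1+l≡m = trans (cong (suc ∘ toℕ) (proj₂ (proj₁ ff _))) (proj₂ (last-index _))
  l<n : l < n
  l<n = chain-index<n extinct x
  x-covered : Covered l x
  x-covered = covered l (<⇒≤ l<n) x ≤-refl
  K : Fin q
  K = proj₁ x-covered
  K-meets : Meets c h b K (suc l)
  K-meets = x , refl , proj₂ (proj₂ x-covered)
  S[1+l]K : S (suc l) K ≡ true
  S[1+l]K = stays l<n (proj₁ (proj₂ x-covered)) (inj₁ K-meets)
  1+l<n : suc l < n
  1+l<n = present⇒<n extinct l<n S[1+l]K
  S[2+l]K : S (suc (suc l)) K ≡ true
  S[2+l]K = stays 1+l<n S[1+l]K (inj₂ (inj₂ (TypeA⇒next-TypeC {S = S} {F = F} s≥2 S[1+l]K K-meets)))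
  2+l<n : suc (suc l) < n
  2+l<n = present⇒<n extinct 1+l<n S[2+l]K
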